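{- Let $G$ be a $k$-cop-win graph and let $H$ be a $1$-point retract of $G$. Then for all integers $m\ge1$, $\operatorname{capt}_k(H,m)\le\operatorname{capt}_k(G,m)$.
   Context: All graphs are finite, simple apart from loops, connected and reflexive. The game of $k$ cops and $m$ robbers: in round $0$ the cops choose starting vertices, then the robbers choose starting vertices (players may share vertices). In each round $i\ge1$ every cop moves to an adjacent vertex or stays, then every robber moves to an adjacent vertex or stays. Whenever a cop occupies the same vertex as some robbers, those robbers are captured and leave the game. $G$ is $k$-cop-win if $k$ cops can always capture one robber. For a $k$-cop-win graph $G$, $\operatorname{capt}_k(G,m)$ is the smallest $t$ such that the $k$ cops have a strategy guaranteeing all $m$ robbers are captured by round $t$ regardless of the robbers' play. An induced subgraph $H$ of $G$ is a retract if there is a homomorphism $f:G\to H$ (a map $V(G)\to V(H)$ sending edges to edges, where by reflexivity adjacent vertices may map to the same vertex) with $f(x)=x$ for all $x\in V(H)$; it is a $1$-point retract if moreover $H=G-u$ for some $u\in V(G)$. (A retract of a $k$-cop-win graph is $k$-cop-win, so $\operatorname{capt}_k(H,m)$ is defined.) -}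

module Defs where

open import Data.Nat using (ℕ; zero; suc; _<_)
open import Data.Fin using (Fin; punchIn)
open import Data.Fin.Properties using (_≟_; any?)
open import Data.Maybe using (Maybe; just; nothing)
open import Data.Product using (Σ; ∃; _×_; _,_)
open import Relation.Nullary using (¬_; yes; no)
open import Relation.Binary.PropositionalEquality using (_≡_)

AdjRel : ℕ → Set₁
AdjRel n = Fin n → Fin n → Set

data Reach {n : ℕ} (Adj : AdjRel n) : Fin n → Fin n → Set where
  here  : ∀ {u} → Reach Adj u u
  there : ∀ {u w v} → Adj u w → Reach Adj w v → Reach Adj u v

record Graph (n : ℕ) : Set₁ where
  field
    Adj       : AdjRel n
    adj-refl  : ∀ v → Adj v v
    adj-sym   : ∀ {u v} → Adj u v → Adj v u
    connected : ∀ u v → Reach Adj u v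
open Graph public

-- The game of k cops and m robbers on (Fin n, Adj).
-- Cops: Fin k → Fin n.  Robbers: Fin m → Maybe (Fin n), nothing = captured.

captureOne : {n k : ℕ} → (Fin k → Fin n) → Maybe (Fin n) → Maybe (Fin n)
captureOne c nothing = nothing
captureOne c (just v) with any? (λ j → c j ≟ v)
... | yes _ = nothing
... | no  _ = just v

capture : {n k m : ℕ} → (Fin k → Fin n) → (Fin m → Maybe (Fin n)) → Fin m → Maybe (Fin n)
capture c r i = captureOne c (r i)

AllCaught : {n m : ℕ} → (Fin m → Maybe (Fin n)) → Set
AllCaught r = ∀ i → r i ≡ nothing

-- legal cop move: each cop moves to an adjacent vertex or stays (Adj is reflexive)
CopStep : {n k : ℕ} → AdjRel n → (Fin k → Fin n) → (Fin k → Fin n) → Set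
CopStep Adj c c' = ∀ j → Adj (c j) (c' j)

data RobStep1 {n : ℕ} (Adj : AdjRel n) : Maybe (Fin n) → Maybe (Fin n) → Set where
  gone : RobStep1 Adj nothing nothing
  move : ∀ {u v} → Adj u v → RobStep1 Adj (just u) (just v)

RobStep : {n m : ℕ} → AdjRel n → (Fin m → Maybe (Fin n)) → (Fin m → Maybe (Fin n)) → Set
RobStep Adj r r' = ∀ i → RobStep1 Adj (r i) (r' i)

-- Win Adj t c r : from the position at the end of a round (cops at c, robbers r,
-- captures already applied), the cops can guarantee that all robbers are
-- captured within at most t further rounds, whatever the robbers do.
data Win {n k m : ℕ} (Adj : AdjRel n) : ℕ → (Fin k → Fin n) → (Fin m → Maybe (Fin n)) → Set where
  done : ∀ {t c r} → AllCaught r → Win Adj t c r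
  step : ∀ {t c r} (c' : Fin k → Fin n) → CopStep Adj c c' →
         (∀ r' → RobStep Adj (capture c' r) r' → Win Adj t c' (capture c' r')) →
         Win Adj (suc t) c r

-- k cops have a strategy guaranteeing capture of all m robbers by round t
-- (round 0: cops place, then robbers place).
CaptWithin : {n : ℕ} → AdjRel n → (k m t : ℕ) → Set
CaptWithin {n} Adj k m t =
  Σ (Fin k → Fin n) λ c₀ → ∀ (r₀ : Fin m → Fin n) → Win Adj t c₀ (capture c₀ (λ i → just (r₀ i)))

IsCaptTime : {n : ℕ} → AdjRel n → (k m t : ℕ) → Set
IsCaptTime Adj k m t = CaptWithin Adj k m t × (∀ s → s < t → ¬ CaptWithin Adj k m s)

KCopWin : {n : ℕ} → Graph n → ℕ → Set
KCopWin G k = ∃ λ t → CaptWithin (Adj G) k 1 t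

-- The induced subgraph G - u, with vertex set Fin n embedded via punchIn u
DelAdj : {n : ℕ} → Graph (suc n) → Fin (suc n) → AdjRel n
DelAdj G u x y = Adj G (punchIn u x) (punchIn u y)

OnePointRetract : {n : ℕ} → Graph (suc n) → Fin (suc n) → Set
OnePointRetract {n} G u =
  Σ (Fin (suc n) → Fin n) λ f →
    (∀ x y → Adj G x y → DelAdj G u (f x) (f y)) × (∀ x → f (punchIn u x) ≡ x)

{-# OPTIONS --safe #-}
module Submission where

-- The cops on a retract H of G play the image under the retraction f of a
-- G-strategy, against the G-robbers obtained by embedding the H-robbers. Every
-- robber move in H embeds into a move in G, and a cop sitting on an embedded
-- robber in G is mapped by f onto that robber in H, so every capture in G is
-- mirrored in H no later.

open import Defs
open import Data.Nat using (ℕ; suc; _≤_)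
open import Data.Nat.Properties using (≮⇒≥)
open import Data.Fin using (Fin; punchIn)
open import Data.Fin.Properties using (_≟_; any?)
open import Data.Maybe using (Maybe; just; nothing)
open import Data.Product using (Σ-syntax; _×_; _,_; proj₁; proj₂)
open import Relation.Nullary using (yes; no; contradiction)
open import Relation.Binary.PropositionalEquality using (_≡_; refl; trans; cong)

robStep1-refl : ∀ {n} {Adj : AdjRel n} → (∀ v → Adj v v) → ∀ a → RobStep1 Adj a a
robStep1-refl refl-adj nothing  = gone
robStep1-refl refl-adj (just v) = move (refl-adj v)

module Retract {N M : ℕ} {AdjG : AdjRel N} {AdjH : AdjRel M}
               (adjG-refl : ∀ v → AdjG v v)
               (ι : Fin M → Fin N) (ι-hom : ∀ {x y} → AdjH x y → AdjG (ι x) (ι y))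
               (f : Fin N → Fin M) (f-hom : ∀ {x y} → AdjG x y → AdjH (f x) (f y))
               (f∘ι≗id : ∀ x → f (ι x) ≡ x) where

  data Embeds : Maybe (Fin N) → Maybe (Fin M) → Set where
    caughtᴴ : ∀ {a} → Embeds a nothing
    embed   : ∀ x → Embeds (just (ι x)) (just x)

  image : ∀ {k} → (Fin k → Fin N) → Fin k → Fin M
  image c j = f (c j)

  captureOne-embeds : ∀ {k} (c : Fin k → Fin N) {a b} → Embeds a b →
                      Embeds (captureOne c a) (captureOne (image c) b)
  captureOne-embeds c caughtᴴ = caughtᴴ
  captureOne-embeds c (embed x) with any? (λ j → c j ≟ ι x) | any? (λ j → image c j ≟ x)
  ... | yes _       | yes _  = caughtᴴ
  ... | yes (j , e) | no ¬hit = contradiction (j , trans (cong f e) (f∘ι≗id x)) ¬hit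
  ... | no _        | yes _  = caughtᴴ
  ... | no _        | no _   = embed x

  embed-robStep1 : ∀ {a b b'} → Embeds a b → RobStep1 AdjH b b' →
                   Σ[ a' ∈ Maybe (Fin N) ] RobStep1 AdjG a a' × Embeds a' b'
  embed-robStep1 {a} caughtᴴ gone                = a , robStep1-refl adjG-refl a , caughtᴴ
  embed-robStep1 (embed x) (move {v = y} adj) = just (ι y) , move (ι-hom adj) , embed y

  embeds-caught : ∀ {a b} → a ≡ nothing → Embeds a b → b ≡ nothing
  embeds-caught _ caughtᴴ = refl

  win-image : ∀ {k m t} {c : Fin k → Fin N}
                {rG : Fin m → Maybe (Fin N)} {rH : Fin m → Maybe (Fin M)} →
              Win AdjG t c rG → (∀ i → Embeds (rG i) (rH i)) → Win AdjH t (image c) rH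
  win-image (done caughtG) emb = done λ i → embeds-caught (caughtG i) (emb i)
  win-image (step c' c→c' win') emb =
    step (image c') (λ j → f-hom (c→c' j)) λ rH' rH→rH' →
      let moves = λ i → embed-robStep1 (captureOne-embeds c' (emb i)) (rH→rH' i)
      in win-image (win' (λ i → proj₁ (moves i)) (λ i → proj₁ (proj₂ (moves i))))
                   (λ i → captureOne-embeds c' (proj₂ (proj₂ (moves i))))

  captWithin-retract : ∀ {k m t} → CaptWithin AdjG k m t → CaptWithin AdjH k m t
  captWithin-retract (c₀ , win) = image c₀ , λ r₀ →
    win-image (win (λ i → ι (r₀ i))) (λ i → captureOne-embeds c₀ (embed (r₀ i)))

captWithin-onePointRetract : ∀ {n k m t} (G : Graph (suc n)) (u : Fin (suc n)) →
                             OnePointRetract G u →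
                             CaptWithin (Adj G) k m t → CaptWithin (DelAdj G u) k m t
captWithin-onePointRetract G u (f , f-hom , f∘punchIn≗id) =
  Retract.captWithin-retract (adj-refl G) (punchIn u) (λ adj → adj)
                             f (f-hom _ _) f∘punchIn≗id

lemma4p5 : ∀ {n : ℕ} (G : Graph (suc n)) (k : ℕ) (u : Fin (suc n)) →
    KCopWin G k → OnePointRetract G u →
    (m : ℕ) → 1 ≤ m → (tG tH : ℕ) →
    IsCaptTime (Adj G) k m tG → IsCaptTime (DelAdj G u) k m tH → tH ≤ tG
lemma4p5 G k u _ retract m _ tG tH (captG , _) (_ , minimalH) =
  ≮⇒≥ λ tG<tH → minimalH tG tG<tH (captWithin-onePointRetract G u retract captG)
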